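{- Let $G$ be an alternating Laguerre digraph on the vertex set $[N]$ (with $\infty$–$\infty$ boundary conditions). Then for every $i\in[N]$: if $i$ is a valley of $G$ then $\mathrm{ulev}(i,G)\equiv i-1\pmod 2$, and if $i$ is a peak of $G$ then $\mathrm{llev}(i,G)\equiv i\pmod 2$.
   Context: A Laguerre digraph on $[N]$ is a directed graph on $[N]$ (loops allowed) in which each vertex has in-degree 0 or 1 and out-degree 0 or 1. With $\infty$–$\infty$ boundary conditions, $p(i)$ is the predecessor of $i$ (or $\infty$ if in-degree 0) and $s(i)$ the successor (or $\infty$ if out-degree 0), $\infty$ exceeding all integers. $i$ is a peak if $p(i)<i>s(i)$, valley if $p(i)>i<s(i)$, double ascent if $p(i)<i<s(i)$, double descent if $p(i)>i>s(i)$, fixed point if $p(i)=i=s(i)$. $G$ is alternating if it has no double ascents, double descents or fixed points. For $j\in[N]$: $\mathrm{ulev}(j,G)=\#\{i\in[N]: i<j,\ j<s(i)\le\infty\}$ if $j<s(j)$, and $0$ otherwise. For $k\in[N]$: $\mathrm{llev}(k,G)=\#\{m\in[N]: m<k,\ k<p(m)\le\infty\}$ if $s(k)<k$, and $0$ otherwise. -}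

module Defs where

open import Data.Nat using (ℕ; zero; suc; _<ᵇ_; _≡ᵇ_)
open import Data.Bool using (Bool; true; false; _∧_; not; T; if_then_else_)
open import Data.Fin using (Fin; toℕ)
open import Data.Maybe using (Maybe; just; nothing)
import Data.Maybe as Maybe
open import Data.List using (List; length; filterᵇ; allFin)
open import Data.Product using (_×_)
open import Relation.Binary.PropositionalEquality using (_≡_)

-- A Laguerre digraph on [N] (vertices Fin N, vertex i ↔ integer toℕ i + 1):
-- every vertex has out-degree ≤ 1 (succ) and in-degree ≤ 1 (pred);
-- nothing = no such neighbour (i.e. the value ∞ under ∞–∞ boundary conditions).
-- succ and pred describe the same edge set: i → j is an edge iff
-- succ i ≡ just j iff pred j ≡ just i.
record LaguerreDigraph (N : ℕ) : Set where
  field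
    succ : Fin N → Maybe (Fin N)
    pred : Fin N → Maybe (Fin N)
    consistent : ∀ i j → (succ i ≡ just j → pred j ≡ just i) × (pred j ≡ just i → succ i ≡ just j)
open LaguerreDigraph public

ℕ∞ : Set
ℕ∞ = Maybe ℕ

_<∞_ : ℕ∞ → ℕ∞ → Bool
just a  <∞ just b  = a <ᵇ b
just _  <∞ nothing = true
nothing <∞ _       = false

_=∞_ : ℕ∞ → ℕ∞ → Bool
just a  =∞ just b  = a ≡ᵇ b
nothing =∞ nothing = true
just _  =∞ nothing = false
nothing =∞ just _  = false

module _ {N : ℕ} (G : LaguerreDigraph N) where
  val : Fin N → ℕ∞
  val i = just (toℕ i)

  s p : Fin N → ℕ∞
  s i = Maybe.map toℕ (succ G i)
  p i = Maybe.map toℕ (pred G i)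

  isPeak isValley isDoubleAscent isDoubleDescent isFixedPoint : Fin N → Bool
  isPeak i          = (p i <∞ val i) ∧ (s i <∞ val i)
  isValley i        = (val i <∞ p i) ∧ (val i <∞ s i)
  isDoubleAscent i  = (p i <∞ val i) ∧ (val i <∞ s i)
  isDoubleDescent i = (val i <∞ p i) ∧ (s i <∞ val i)
  isFixedPoint i    = (p i =∞ val i) ∧ (val i =∞ s i)

  Alternating : Set
  Alternating = ∀ i → T (not (isDoubleAscent i)) × T (not (isDoubleDescent i)) × T (not (isFixedPoint i))

  count : (Fin N → Bool) → ℕ
  count P = length (filterᵇ P (allFin N))

  ulev : Fin N → ℕ
  ulev j = if val j <∞ s j
           then count (λ i → (val i <∞ val j) ∧ (val j <∞ s i))
           else 0

  llev : Fin N → ℕ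
  llev k = if s k <∞ val k
           then count (λ m → (val m <∞ val k) ∧ (val k <∞ p m))
           else 0

-- Vertices are labelled 0, …, N − 1.  Let E(m) count the edges i → s(i) with both ends
-- below m.  Passing from m to m + 1 adds the edge into m if p(m) < m and the edge out of m
-- if s(m) < m; in an alternating digraph every vertex is a loop-free peak or valley, so
-- either both or neither is added, and E(m) is always even.  Sorting the k vertices below k
-- by whether their successor lies above k, at k, or below k gives
-- k = #{j < k < s(j)} + [p(k) < k] + E(k).  At a valley this is ulev + 0 + even; at a
-- peak, the same identity for the reversed digraph reads llev + 1 + even.
{-# OPTIONS --safe #-}
module Submission where

open import Defs
open import Data.Bool using (Bool; true; false; T; _∧_; not; if_then_else_)
open import Data.Bool.Properties using (∧-comm; T-≡; T-∧)
open import Data.Empty using (⊥-elim)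
open import Data.Fin as Fin using (Fin; toℕ; fromℕ<)
open import Data.Fin.Properties using (toℕ<n; toℕ-injective; toℕ-fromℕ<; punchInᵢ≢i)
open import Data.List using (length; filterᵇ; tabulate)
open import Data.Maybe using (Maybe; just; nothing; maybe)
open import Data.Maybe.Properties using (just-injective)
import Data.Maybe as Maybe
open import Data.Nat using (ℕ; zero; suc; _+_; _*_; _%_; _<ᵇ_; _≡ᵇ_; _≤_; s≤s)
open import Data.Nat.Divisibility using (_∣_; divides; ∣m∣n⇒∣m+n)
open import Data.Nat.DivMod using ([m+kn]%n≡m%n; %-distribˡ-+)
open import Data.Nat.Properties
  using (+-0-commutativeMonoid; +-identityʳ; +-assoc; +-comm; *-comm; *-identityˡ; *-identityʳ;
         *-distribˡ-+; *-distribʳ-+; ≡ᵇ⇒≡; ≡⇒≡ᵇ; <ᵇ⇒<; <-asym; <⇒≤)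
open import Data.Product using (_×_; _,_; proj₁; proj₂)
open import Function using (_∘_; id; Equivalence; _⇔_; mk⇔)
open import Relation.Nullary using (¬_)
open import Relation.Binary.PropositionalEquality

open import Algebra.Properties.CommutativeMonoid.Sum +-0-commutativeMonoid
  using (sum; sum-cong-≗; sum-remove; ∑-distrib-+; sum-replicate-zero)

open Equivalence using (to; from)

χ : Bool → ℕ
χ true  = 1
χ false = 0

χ-∧ : ∀ a b → χ (a ∧ b) ≡ χ a * χ b
χ-∧ true  true  = refl
χ-∧ true  false = refl
χ-∧ false _     = refl

χ-T : ∀ {b} → T b → χ b ≡ 1
χ-T {true} _ = refl

χ-¬T : ∀ {b} → ¬ T b → χ b ≡ 0
χ-¬T {true}  ¬b = ⊥-elim (¬b _)
χ-¬T {false} _  = refl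

χ-cong : ∀ {a b} → T a ⇔ T b → χ a ≡ χ b
χ-cong {true}  {true}  _   = refl
χ-cong {true}  {false} a⇔b = ⊥-elim (to a⇔b _)
χ-cong {false} {true}  a⇔b = ⊥-elim (from a⇔b _)
χ-cong {false} {false} _   = refl

length-filterᵇ-tabulate : ∀ {n} {A : Set} (P : A → Bool) (f : Fin n → A) →
  length (filterᵇ P (tabulate f)) ≡ sum (χ ∘ P ∘ f)
length-filterᵇ-tabulate {zero}  P f = refl
length-filterᵇ-tabulate {suc n} P f with P (f Fin.zero)
... | true  = cong suc (length-filterᵇ-tabulate P (f ∘ Fin.suc))
... | false = length-filterᵇ-tabulate P (f ∘ Fin.suc)

sum-zero : ∀ {n} {f : Fin n → ℕ} → (∀ i → f i ≡ 0) → sum f ≡ 0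
sum-zero {n} f≗0 = trans (sum-cong-≗ f≗0) (sum-replicate-zero n)

sum-single : ∀ {n} (f : Fin n → ℕ) (k : Fin n) → (∀ i → i ≢ k → f i ≡ 0) → sum f ≡ f k
sum-single {suc n} f k f≡0 = begin
  sum f                         ≡⟨ sum-remove {i = k} f ⟩
  f k + sum (f ∘ Fin.punchIn k) ≡⟨ cong (f k +_) (sum-zero (λ j → f≡0 _ (punchInᵢ≢i k j))) ⟩
  f k + 0                       ≡⟨ +-identityʳ (f k) ⟩
  f k                           ∎
  where open ≡-Reasoning

sum-χ-toℕ<ᵇ : ∀ {n} m → m ≤ n → sum {n} (λ j → χ (toℕ j <ᵇ m)) ≡ m
sum-χ-toℕ<ᵇ {n} zero _        = sum-zero {n} (λ _ → refl)
sum-χ-toℕ<ᵇ (suc m) (s≤s m≤n) = cong suc (sum-χ-toℕ<ᵇ m m≤n)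

=∞-refl : ∀ x → T (x =∞ x)
=∞-refl nothing  = _
=∞-refl (just a) = ≡⇒≡ᵇ a a refl

=∞-sym : ∀ x y → (x =∞ y) ≡ (y =∞ x)
=∞-sym nothing        nothing        = refl
=∞-sym nothing        (just _)       = refl
=∞-sym (just _)       nothing        = refl
=∞-sym (just zero)    (just zero)    = refl
=∞-sym (just zero)    (just (suc _)) = refl
=∞-sym (just (suc _)) (just zero)    = refl
=∞-sym (just (suc a)) (just (suc b)) = =∞-sym (just a) (just b)

<∞-asym : ∀ x y → T (x <∞ y) → ¬ T (y <∞ x)
<∞-asym (just a) (just b) a<b b<a = <-asym (<ᵇ⇒< a b a<b) (<ᵇ⇒< b a b<a)
<∞-asym (just _) nothing  _   ()

<∞-trichotomy : ∀ m x → χ (just m <∞ x) + χ (x =∞ just m) + χ (x <∞ just m) ≡ 1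
<∞-trichotomy _       nothing        = refl
<∞-trichotomy zero    (just zero)    = refl
<∞-trichotomy zero    (just (suc _)) = refl
<∞-trichotomy (suc _) (just zero)    = refl
<∞-trichotomy (suc m) (just (suc a)) = <∞-trichotomy m (just a)

¬=∞⇒<∞-flip : ∀ m x → ¬ T (x =∞ just m) → (just m <∞ x) ≡ not (x <∞ just m)
¬=∞⇒<∞-flip _       nothing        _   = refl
¬=∞⇒<∞-flip zero    (just zero)    x≠m = ⊥-elim (x≠m _)
¬=∞⇒<∞-flip zero    (just (suc _)) _   = refl
¬=∞⇒<∞-flip (suc _) (just zero)    _   = refl
¬=∞⇒<∞-flip (suc m) (just (suc a)) x≠m = ¬=∞⇒<∞-flip m (just a) x≠m

χ-<∞-suc : ∀ x m → χ (x <∞ just (suc m)) ≡ χ (x <∞ just m) + χ (x =∞ just m)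
χ-<∞-suc nothing        _       = refl
χ-<∞-suc (just zero)    zero    = refl
χ-<∞-suc (just zero)    (suc _) = refl
χ-<∞-suc (just (suc _)) zero    = refl
χ-<∞-suc (just (suc a)) (suc m) = χ-<∞-suc (just a) m

=∞-map-toℕ : ∀ {n} (x y : Maybe (Fin n)) → T (Maybe.map toℕ x =∞ Maybe.map toℕ y) ⇔ x ≡ y
=∞-map-toℕ x y = mk⇔ (to′ x y) (λ { refl → =∞-refl (Maybe.map toℕ x) })
  where
  to′ : ∀ x y → T (Maybe.map toℕ x =∞ Maybe.map toℕ y) → x ≡ y
  to′ nothing  nothing  _ = refl
  to′ (just a) (just b) t = cong just (toℕ-injective (≡ᵇ⇒≡ (toℕ a) (toℕ b) t))

sum-sift : ∀ {n} (f : Fin n → ℕ) (y : Maybe (Fin n)) →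
  sum (λ j → χ (just (toℕ j) =∞ Maybe.map toℕ y) * f j) ≡ maybe f 0 y
sum-sift {n} f nothing = sum-zero {n} (λ _ → refl)
sum-sift f (just k) = trans (sum-single _ k off) on
  where
  off : ∀ j → j ≢ k → χ (toℕ j ≡ᵇ toℕ k) * f j ≡ 0
  off j j≢k = cong (_* f j) (χ-¬T (j≢k ∘ just-injective ∘ to (=∞-map-toℕ (just j) (just k))))
  on : χ (toℕ k ≡ᵇ toℕ k) * f k ≡ f k
  on = trans (cong (_* f k) (χ-T (=∞-refl (just (toℕ k))))) (*-identityˡ (f k))

[m+n]%2≡m%2 : ∀ m {n} → 2 ∣ n → (m + n) % 2 ≡ m % 2
[m+n]%2≡m%2 m (divides q refl) = [m+kn]%n≡m%n m q 2

[m+1]%2≡n%2⇒m%2≡[1+n]%2 : ∀ m n → (m + 1) % 2 ≡ n % 2 → m % 2 ≡ suc n % 2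
[m+1]%2≡n%2⇒m%2≡[1+n]%2 m n eq = begin
  m % 2                     ≡⟨ sym ([m+kn]%n≡m%n m 1 2) ⟩
  (m + 2) % 2               ≡⟨ cong (_% 2) (sym (+-assoc m 1 1)) ⟩
  (m + 1 + 1) % 2           ≡⟨ %-distribˡ-+ (m + 1) 1 2 ⟩
  ((m + 1) % 2 + 1 % 2) % 2 ≡⟨ cong (λ r → (r + 1 % 2) % 2) eq ⟩
  (n % 2 + 1 % 2) % 2       ≡⟨ sym (%-distribˡ-+ n 1 2) ⟩
  (n + 1) % 2               ≡⟨ cong (_% 2) (+-comm n 1) ⟩
  suc n % 2                 ∎
  where open ≡-Reasoning

2∣n+n : ∀ n → 2 ∣ n + n
2∣n+n n = divides n (trans (cong (n +_) (sym (+-identityʳ n))) (*-comm 2 n))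

no-mismatch⇒≡ : ∀ a b → T (not (a ∧ not b)) → T (not (not a ∧ b)) → a ≡ b
no-mismatch⇒≡ true  true  _ _ = refl
no-mismatch⇒≡ false false _ _ = refl

T-not⇒¬T : ∀ {b} → T (not b) → ¬ T b
T-not⇒¬T {true} ()

reverse : ∀ {N} → LaguerreDigraph N → LaguerreDigraph N
reverse G = record
  { succ       = pred G
  ; pred       = succ G
  ; consistent = λ i j → proj₂ (consistent G j i) , proj₁ (consistent G j i)
  }

module _ {N : ℕ} (G : LaguerreDigraph N) where

  crossings : Fin N → ℕ
  crossings k = count G (λ i → (val G i <∞ val G k) ∧ (val G k <∞ s G i))

  edgesBelow : ℕ → ℕ
  edgesBelow m = sum (λ i → χ (toℕ i <ᵇ m) * χ (s G i <∞ just m))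

  ulev≡crossings : ∀ k → T (val G k <∞ s G k) → ulev G k ≡ crossings k
  ulev≡crossings k k<s = cong (λ b → if b then crossings k else 0) (to T-≡ k<s)

  count-∧ : ∀ (P Q : Fin N → Bool) → count G (λ i → P i ∧ Q i) ≡ sum (λ i → χ (P i) * χ (Q i))
  count-∧ P Q = trans (length-filterᵇ-tabulate (λ i → P i ∧ Q i) id) (sum-cong-≗ (λ i → χ-∧ (P i) (Q i)))

  s=∞⇔p=∞ : ∀ i k → T (s G i =∞ val G k) ⇔ T (val G i =∞ p G k)
  s=∞⇔p=∞ i k = mk⇔
    (from (=∞-map-toℕ (just i) (pred G k)) ∘ sym ∘ proj₁ (consistent G i k) ∘ to (=∞-map-toℕ (succ G i) (just k)))
    (from (=∞-map-toℕ (succ G i) (just k)) ∘ proj₂ (consistent G i k) ∘ sym ∘ to (=∞-map-toℕ (just i) (pred G k)))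

  sum-predecessor-below : ∀ k →
    sum (λ i → χ (toℕ i <ᵇ toℕ k) * χ (s G i =∞ val G k)) ≡ χ (p G k <∞ val G k)
  sum-predecessor-below k = begin
    sum (λ i → χ (toℕ i <ᵇ toℕ k) * χ (s G i =∞ val G k)) ≡⟨ sum-cong-≗ swap ⟩
    sum (λ i → χ (val G i =∞ p G k) * χ (toℕ i <ᵇ toℕ k)) ≡⟨ sum-sift _ (pred G k) ⟩
    maybe (λ i → χ (toℕ i <ᵇ toℕ k)) 0 (pred G k)         ≡⟨ maybe-below (pred G k) ⟩
    χ (p G k <∞ val G k)                                   ∎
    where
    open ≡-Reasoning
    swap : ∀ i → χ (toℕ i <ᵇ toℕ k) * χ (s G i =∞ val G k) ≡ χ (val G i =∞ p G k) * χ (toℕ i <ᵇ toℕ k)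
    swap i = trans (*-comm (χ (toℕ i <ᵇ toℕ k)) (χ (s G i =∞ val G k))) (cong (_* _) (χ-cong (s=∞⇔p=∞ i k)))
    maybe-below : ∀ y → maybe (λ i → χ (toℕ i <ᵇ toℕ k)) 0 y ≡ χ (Maybe.map toℕ y <∞ val G k)
    maybe-below nothing  = refl
    maybe-below (just _) = refl

  crossings-partition : ∀ k → crossings k + χ (p G k <∞ val G k) + edgesBelow (toℕ k) ≡ toℕ k
  crossings-partition k = begin
    crossings k + χ (p G k <∞ val G k) + edgesBelow m
      ≡⟨ cong₂ (λ a c → a + c + edgesBelow m)
               (count-∧ (λ i → toℕ i <ᵇ m) (λ i → just m <∞ s G i)) (sym (sum-predecessor-below k)) ⟩
    sum (λ i → below i * above i) + sum (λ i → below i * hit i) + sum (λ i → below i * under i)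
      ≡⟨ cong (_+ sum (λ i → below i * under i)) (sym (∑-distrib-+ (λ i → below i * above i) _)) ⟩
    sum (λ i → below i * above i + below i * hit i) + sum (λ i → below i * under i)
      ≡⟨ sym (∑-distrib-+ (λ i → below i * above i + below i * hit i) _) ⟩
    sum (λ i → below i * above i + below i * hit i + below i * under i)
      ≡⟨ sum-cong-≗ trichotomy ⟩
    sum below
      ≡⟨ sum-χ-toℕ<ᵇ m (<⇒≤ (toℕ<n k)) ⟩
    m ∎
    where
    open ≡-Reasoning
    m = toℕ k
    below above hit under : Fin N → ℕ
    below i = χ (toℕ i <ᵇ m)
    above i = χ (just m <∞ s G i)
    hit   i = χ (s G i =∞ just m)
    under i = χ (s G i <∞ just m)
    trichotomy : ∀ i → below i * above i + below i * hit i + below i * under i ≡ below i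
    trichotomy i = begin
      below i * above i + below i * hit i + below i * under i
        ≡⟨ cong (_+ below i * under i) (sym (*-distribˡ-+ (below i) (above i) (hit i))) ⟩
      below i * (above i + hit i) + below i * under i
        ≡⟨ sym (*-distribˡ-+ (below i) (above i + hit i) (under i)) ⟩
      below i * (above i + hit i + under i)
        ≡⟨ cong (below i *_) (<∞-trichotomy m (s G i)) ⟩
      below i * 1
        ≡⟨ *-identityʳ (below i) ⟩
      below i ∎

  edgesBelow-suc : ∀ k → ¬ T (s G k =∞ val G k) →
    edgesBelow (suc (toℕ k)) ≡ edgesBelow (toℕ k) + (χ (p G k <∞ val G k) + χ (s G k <∞ val G k))
  edgesBelow-suc k k↛k = begin
    edgesBelow (suc m)
      ≡⟨ sum-cong-≗ (λ i → cong (_* inside i) (χ-<∞-suc (val G i) m)) ⟩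
    sum (λ i → (χ (toℕ i <ᵇ m) + χ (toℕ i ≡ᵇ m)) * inside i)
      ≡⟨ sum-cong-≗ (λ i → *-distribʳ-+ (inside i) (χ (toℕ i <ᵇ m)) (χ (toℕ i ≡ᵇ m))) ⟩
    sum (λ i → χ (toℕ i <ᵇ m) * inside i + χ (toℕ i ≡ᵇ m) * inside i)
      ≡⟨ ∑-distrib-+ (λ i → χ (toℕ i <ᵇ m) * inside i) _ ⟩
    sum (λ i → χ (toℕ i <ᵇ m) * inside i) + sum (λ i → χ (toℕ i ≡ᵇ m) * inside i)
      ≡⟨ cong₂ _+_ sources-below (sum-sift inside (just k)) ⟩
    edgesBelow m + χ (p G k <∞ val G k) + χ (s G k <∞ just (suc m))
      ≡⟨ cong (edgesBelow m + χ (p G k <∞ val G k) +_) target-of-k ⟩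
    edgesBelow m + χ (p G k <∞ val G k) + χ (s G k <∞ val G k)
      ≡⟨ +-assoc (edgesBelow m) _ _ ⟩
    edgesBelow m + (χ (p G k <∞ val G k) + χ (s G k <∞ val G k)) ∎
    where
    open ≡-Reasoning
    m = toℕ k
    inside : Fin N → ℕ
    inside i = χ (s G i <∞ just (suc m))
    sources-below : sum (λ i → χ (toℕ i <ᵇ m) * inside i) ≡ edgesBelow m + χ (p G k <∞ val G k)
    sources-below = begin
      sum (λ i → χ (toℕ i <ᵇ m) * inside i)
        ≡⟨ sum-cong-≗ (λ i → trans (cong (χ (toℕ i <ᵇ m) *_) (χ-<∞-suc (s G i) m))
                                   (*-distribˡ-+ (χ (toℕ i <ᵇ m)) _ _)) ⟩
      sum (λ i → χ (toℕ i <ᵇ m) * χ (s G i <∞ just m) + χ (toℕ i <ᵇ m) * χ (s G i =∞ just m))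
        ≡⟨ ∑-distrib-+ (λ i → χ (toℕ i <ᵇ m) * χ (s G i <∞ just m)) _ ⟩
      edgesBelow m + sum (λ i → χ (toℕ i <ᵇ m) * χ (s G i =∞ just m))
        ≡⟨ cong (edgesBelow m +_) (sum-predecessor-below k) ⟩
      edgesBelow m + χ (p G k <∞ val G k) ∎
    target-of-k : χ (s G k <∞ just (suc m)) ≡ χ (s G k <∞ val G k)
    target-of-k = begin
      χ (s G k <∞ just (suc m))                   ≡⟨ χ-<∞-suc (s G k) m ⟩
      χ (s G k <∞ val G k) + χ (s G k =∞ val G k) ≡⟨ cong (χ (s G k <∞ val G k) +_) (χ-¬T k↛k) ⟩
      χ (s G k <∞ val G k) + 0                    ≡⟨ +-identityʳ _ ⟩
      χ (s G k <∞ val G k)                        ∎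

  isFixedPoint-loop : ∀ k → succ G k ≡ just k → T (isFixedPoint G k)
  isFixedPoint-loop k loop = from T-∧
    ( from (=∞-map-toℕ (pred G k) (just k)) (proj₁ (consistent G k k) loop)
    , from (=∞-map-toℕ (just k) (succ G k)) (sym loop) )

  module _ (alt : Alternating G) where

    loopless : ∀ k → succ G k ≢ just k
    loopless k = T-not⇒¬T (proj₂ (proj₂ (alt k))) ∘ isFixedPoint-loop k

    s≢self : ∀ k → ¬ T (s G k =∞ val G k)
    s≢self k = loopless k ∘ to (=∞-map-toℕ (succ G k) (just k))

    p≢self : ∀ k → ¬ T (p G k =∞ val G k)
    p≢self k = loopless k ∘ proj₂ (consistent G k k) ∘ to (=∞-map-toℕ (pred G k) (just k))

    peak-or-valley : ∀ k → (p G k <∞ val G k) ≡ (s G k <∞ val G k)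
    peak-or-valley k = no-mismatch⇒≡ (p G k <∞ val G k) (s G k <∞ val G k) noDoubleAscent noDoubleDescent
      where
      noDoubleAscent : T (not ((p G k <∞ val G k) ∧ not (s G k <∞ val G k)))
      noDoubleAscent = subst (λ b → T (not ((p G k <∞ val G k) ∧ b)))
        (¬=∞⇒<∞-flip (toℕ k) (s G k) (s≢self k)) (proj₁ (alt k))
      noDoubleDescent : T (not (not (p G k <∞ val G k) ∧ (s G k <∞ val G k)))
      noDoubleDescent = subst (λ b → T (not (b ∧ (s G k <∞ val G k))))
        (¬=∞⇒<∞-flip (toℕ k) (p G k) (p≢self k)) (proj₁ (proj₂ (alt k)))

    edgesBelow-even : ∀ m → m ≤ N → 2 ∣ edgesBelow m
    edgesBelow-even zero    _   = divides 0 (sum-zero {N} (λ _ → refl))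
    edgesBelow-even (suc m) m<N =
      subst (λ j → 2 ∣ edgesBelow (suc j)) (toℕ-fromℕ< m<N) (even-suc (fromℕ< m<N)
        (subst (λ j → 2 ∣ edgesBelow j) (sym (toℕ-fromℕ< m<N)) (edgesBelow-even m (<⇒≤ m<N))))
      where
      even-suc : ∀ k → 2 ∣ edgesBelow (toℕ k) → 2 ∣ edgesBelow (suc (toℕ k))
      even-suc k 2∣E = subst (2 ∣_) (sym (edgesBelow-suc k (s≢self k)))
        (∣m∣n⇒∣m+n 2∣E (subst (λ c → 2 ∣ c + χ (s G k <∞ val G k))
                              (cong χ (sym (peak-or-valley k))) (2∣n+n (χ (s G k <∞ val G k)))))

    crossings-parity : ∀ k → (crossings k + χ (p G k <∞ val G k)) % 2 ≡ toℕ k % 2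
    crossings-parity k = begin
      (crossings k + χ (p G k <∞ val G k)) % 2
        ≡⟨ sym ([m+n]%2≡m%2 (crossings k + χ (p G k <∞ val G k)) (edgesBelow-even (toℕ k) (<⇒≤ (toℕ<n k)))) ⟩
      (crossings k + χ (p G k <∞ val G k) + edgesBelow (toℕ k)) % 2
        ≡⟨ cong (_% 2) (crossings-partition k) ⟩
      toℕ k % 2 ∎
      where open ≡-Reasoning

Alternating-reverse : ∀ {N} {G : LaguerreDigraph N} → Alternating G → Alternating (reverse G)
Alternating-reverse {G = G} alt k = noDoubleAscent , noDoubleDescent , noFixedPoint
  where
  noDoubleAscent : T (not ((s G k <∞ val G k) ∧ (val G k <∞ p G k)))
  noDoubleAscent = subst (T ∘ not) (∧-comm (val G k <∞ p G k) (s G k <∞ val G k)) (proj₁ (proj₂ (alt k)))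
  noDoubleDescent : T (not ((val G k <∞ s G k) ∧ (p G k <∞ val G k)))
  noDoubleDescent = subst (T ∘ not) (∧-comm (p G k <∞ val G k) (val G k <∞ s G k)) (proj₁ (alt k))
  noFixedPoint : T (not ((s G k =∞ val G k) ∧ (val G k =∞ p G k)))
  noFixedPoint = subst (T ∘ not)
    (trans (∧-comm (p G k =∞ val G k) (val G k =∞ s G k))
           (cong₂ _∧_ (=∞-sym (val G k) (s G k)) (=∞-sym (p G k) (val G k))))
    (proj₂ (proj₂ (alt k)))

llev≡crossings-reverse : ∀ {N} (G : LaguerreDigraph N) k →
  T (s G k <∞ val G k) → llev G k ≡ crossings (reverse G) k
llev≡crossings-reverse G k s<k = cong (λ b → if b then crossings (reverse G) k else 0) (to T-≡ s<k)

lemma6p14 : (N : ℕ) (G : LaguerreDigraph N) → Alternating G → (i : Fin N) →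
    (T (isValley G i) → ulev G i % 2 ≡ toℕ i % 2) ×
    (T (isPeak G i) → llev G i % 2 ≡ suc (toℕ i) % 2)
lemma6p14 N G alt i = valley , peak
  where
  open ≡-Reasoning
  valley : T (isValley G i) → ulev G i % 2 ≡ toℕ i % 2
  valley v = begin
    ulev G i % 2
      ≡⟨ cong (_% 2) (trans (ulev≡crossings G i i<s) (sym (+-identityʳ (crossings G i)))) ⟩
    (crossings G i + 0) % 2
      ≡⟨ cong (λ n → (crossings G i + n) % 2) (sym (χ-¬T (<∞-asym (val G i) (p G i) i<p))) ⟩
    (crossings G i + χ (p G i <∞ val G i)) % 2
      ≡⟨ crossings-parity G alt i ⟩
    toℕ i % 2 ∎
    where
    i<p : T (val G i <∞ p G i)
    i<p = proj₁ (to T-∧ v)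
    i<s : T (val G i <∞ s G i)
    i<s = proj₂ (to T-∧ v)
  peak : T (isPeak G i) → llev G i % 2 ≡ suc (toℕ i) % 2
  peak pk = [m+1]%2≡n%2⇒m%2≡[1+n]%2 (llev G i) (toℕ i) (begin
    (llev G i + 1) % 2
      ≡⟨ cong₂ (λ n c → (n + c) % 2) (llev≡crossings-reverse G i s<i) (sym (χ-T s<i)) ⟩
    (crossings (reverse G) i + χ (s G i <∞ val G i)) % 2
      ≡⟨ crossings-parity (reverse G) (Alternating-reverse {G = G} alt) i ⟩
    toℕ i % 2 ∎)
    where
    s<i : T (s G i <∞ val G i)
    s<i = proj₂ (to T-∧ pk)
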